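{- The $q$-central Delannoy numbers $D_n(q)=\sum_{k=0}^n\binom{n+k}{n-k}\binom{2k}{k}q^{n-k}$, $n\ge0$, form a $q$-log-convex sequence.
   Context: For real polynomials, $f(q)\le_q g(q)$ means $g-f$ has nonnegative coefficients; $\{P_n(q)\}_{n\ge0}$ is $q$-log-convex if $P_n(q)^2\le_q P_{n-1}(q)P_{n+1}(q)$ for all $n\ge1$. -}

module Defs where

open import Data.Nat using (ℕ; zero; suc; _+_; _*_; _∸_)
open import Data.Nat.Combinatorics using (_C_)
open import Data.Integer using (ℤ; +_; _≤_) renaming (_+_ to _+ℤ_; _*_ to _*ℤ_; _-_ to _-ℤ_)
open import Data.Bool using (if_then_else_)
open import Data.Nat using (_≡ᵇ_)

-- A polynomial with integer coefficients, represented by its coefficient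
-- function: (P m) is the coefficient of q^m.  (Only finitely supported
-- functions arise below.)
Poly : Set
Poly = ℕ → ℤ

sumℤ : ℕ → (ℕ → ℤ) → ℤ
sumℤ zero    f = f 0
sumℤ (suc n) f = sumℤ n f +ℤ f (suc n)

_·_ : Poly → Poly → Poly
(f · g) m = sumℤ m (λ i → f i *ℤ g (m ∸ i))

mono : ℕ → ℕ → Poly
mono c e m = if m ≡ᵇ e then + c else + 0

_≤q_ : Poly → Poly → Set
f ≤q g = ∀ m → (+ 0) ≤ (g m -ℤ f m)

D : ℕ → Poly
D n m = sumℤ n (λ k → mono (((n + k) C (n ∸ k)) * ((2 * k) C k)) (n ∸ k) m)

q-log-convex : (ℕ → Poly) → Set
q-log-convex P = ∀ n → (P (suc n) · P (suc n)) ≤q (P n · P (suc (suc n)))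

{-# OPTIONS --safe #-}
-- Clearing the factorials in C(m+2k, m) C(2k, k) = (m+2k)! / (m! k! k!) turns the coefficientwise form of
-- the recurrence (n+1) D_{n+1} + n q² D_{n-1} = (2n+1)(q+2) D_n into a polynomial identity in m and k.
-- Convolving the recurrence at n+1 with D_n and the one at n with D_{n+1}, and eliminating the common
-- term (q+2) D_n D_{n+1}, gives
--   (2n+1)(n+2) (D_n D_{n+2} - D_{n+1}²) = (D_{n+1}² - q² D_n²) + n(2n+3) q² (D_{n-1} D_{n+1} - D_n²).
-- As 0 ≤_q q D_n ≤_q D_{n+1}, the first summand is ≥_q 0, so q-log-convexity follows by induction on n.
module Submission where

open import Relation.Binary.PropositionalEquality

open import Defs

module DelannoyCoefficients where

  open import Data.Nat using (ℕ; zero; suc; pred; _+_; _*_; _∸_; _≤_; _!; s≤s; NonZero)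
  open import Data.Nat.Properties
    using ( m+n∸m≡n; m≤m+n; *-assoc; *-identityʳ; +-identityʳ; *-cancelʳ-≡; *-cancelʳ-≤; *-monoˡ-≤
          ; m*n≢0; _!≢0; _!*_!≢0; module ≤-Reasoning)
  open import Data.Nat.Combinatorics using (_C_; nCk≡n!/k![n-k]!; k![n∸k]!∣n!; nCn≡1)
  open import Data.Nat.DivMod using (m/n*n≡m)
  open import Data.Nat.Tactic.RingSolver using (solve-∀)

  binomial-factorial : ∀ {n} m j → m + j ≡ n → (n C m) * (m ! * j !) ≡ n !
  binomial-factorial m j refl = begin
    ((m + j) C m) * (m ! * j !)       ≡⟨ cong (λ i → ((m + j) C m) * (m ! * i !)) (m+n∸m≡n m j) ⟨
    ((m + j) C m) * (m ! * (m + j ∸ m) !) ≡⟨ cong (_* (m ! * (m + j ∸ m) !)) (nCk≡n!/k![n-k]! m≤m+j) ⟩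
    _                                   ≡⟨ m/n*n≡m {{m !* (m + j ∸ m) !≢0}} (k![n∸k]!∣n! m≤m+j) ⟩
    (m + j) !                           ∎
    where
    open ≡-Reasoning
    m≤m+j = m≤m+n m j

  dcoeff : ℕ → ℕ → ℕ
  dcoeff m k = ((m + 2 * k) C m) * ((2 * k) C k)

  dcoeff-factorial : ∀ m k → dcoeff m k * (m ! * (k ! * k !)) ≡ (m + 2 * k) !
  dcoeff-factorial m k = begin
    (a * b) * (m ! * (k ! * k !)) ≡⟨ regroup a b (m !) (k ! * k !) ⟩
    a * (m ! * (b * (k ! * k !))) ≡⟨ cong (λ x → a * (m ! * x)) (binomial-factorial k k (k+k≡2k k)) ⟩
    a * (m ! * (2 * k) !)         ≡⟨ binomial-factorial m (2 * k) refl ⟩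
    (m + 2 * k) !                 ∎
    where
    open ≡-Reasoning
    a = (m + 2 * k) C m
    b = (2 * k) C k
    regroup : ∀ a b x y → (a * b) * (x * y) ≡ a * (x * (b * y))
    regroup = solve-∀
    k+k≡2k : ∀ k → k + k ≡ 2 * k
    k+k≡2k = solve-∀

  dcoeff-diag : ∀ n → dcoeff n 0 ≡ 1
  dcoeff-diag n = trans (*-identityʳ _) (trans (cong (_C n) (+-identityʳ n)) (nCn≡1 n))

  -- Clearing denominators: with w = i! ((k+1)!)² and r = i + 2k, each coefficient entering
  -- the recurrence at degree i of D_{i+k} becomes a polynomial multiple of r!.
  weight : ℕ → ℕ → ℕ
  weight i k = i ! * (suc k ! * suc k !)

  weight≢0 : ∀ i k → NonZero (weight i k)
  weight≢0 i k = m*n≢0 (i !) _ {{i !≢0}} {{suc k !* suc k !≢0}}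

  weighted-D-next : ∀ i k → dcoeff i (suc k) * weight i k ≡ (2 + (i + 2 * k)) * (1 + (i + 2 * k)) * (i + 2 * k) !
  weighted-D-next i k = begin
    dcoeff i (suc k) * weight i k ≡⟨ dcoeff-factorial i (suc k) ⟩
    (i + 2 * suc k) !             ≡⟨ cong _! (index i k) ⟩
    (2 + (i + 2 * k)) !           ≡⟨ *-assoc (2 + (i + 2 * k)) (1 + (i + 2 * k)) ((i + 2 * k) !) ⟨
    (2 + (i + 2 * k)) * (1 + (i + 2 * k)) * (i + 2 * k) ! ∎
    where
    open ≡-Reasoning
    index : ∀ i k → i + 2 * suc k ≡ 2 + (i + 2 * k)
    index = solve-∀

  -- dcoeff (i - 1) (k + 1) and dcoeff (i - 2) (k + 1), read as 0 when the first index is negative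
  dcoeff-pred : ℕ → ℕ → ℕ
  dcoeff-pred zero    k = 0
  dcoeff-pred (suc i) k = dcoeff i (suc k)

  dcoeff-pred² : ℕ → ℕ → ℕ
  dcoeff-pred² zero    k = 0
  dcoeff-pred² (suc i) k = dcoeff-pred i k

  weighted-qD : ∀ i k → dcoeff-pred i k * weight i k ≡ i * (1 + (i + 2 * k)) * (i + 2 * k) !
  weighted-qD zero    k = refl
  weighted-qD (suc j) k = begin
    dcoeff j (suc k) * weight (suc j) k  ≡⟨ regroup (dcoeff j (suc k)) (suc j) (j !) (suc k ! * suc k !) ⟩
    suc j * (dcoeff j (suc k) * weight j k) ≡⟨ cong (suc j *_) (dcoeff-factorial j (suc k)) ⟩
    suc j * (j + 2 * suc k) !            ≡⟨ cong (λ r → suc j * r !) (index j k) ⟩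
    suc j * (1 + (suc j + 2 * k)) !      ≡⟨ *-assoc (suc j) (1 + (suc j + 2 * k)) ((suc j + 2 * k) !) ⟨
    suc j * (1 + (suc j + 2 * k)) * (suc j + 2 * k) ! ∎
    where
    open ≡-Reasoning
    regroup : ∀ d s f w → d * ((s * f) * w) ≡ s * (d * (f * w))
    regroup = solve-∀
    index : ∀ j k → j + 2 * suc k ≡ 1 + (suc j + 2 * k)
    index = solve-∀

  weighted-q²D-prev : ∀ i k → dcoeff-pred² i k * weight i k ≡ i * pred i * (i + 2 * k) !
  weighted-q²D-prev zero          k = refl
  weighted-q²D-prev (suc zero)    k = refl
  weighted-q²D-prev (suc (suc j)) k = begin
    dcoeff j (suc k) * weight (2 + j) k       ≡⟨ regroup (dcoeff j (suc k)) (2 + j) (1 + j) (j !) (suc k ! * suc k !) ⟩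
    (2 + j) * (1 + j) * (dcoeff j (suc k) * weight j k) ≡⟨ cong ((2 + j) * (1 + j) *_) (dcoeff-factorial j (suc k)) ⟩
    (2 + j) * (1 + j) * (j + 2 * suc k) !     ≡⟨ cong (λ r → (2 + j) * (1 + j) * r !) (index j k) ⟩
    (2 + j) * (1 + j) * (2 + j + 2 * k) !     ∎
    where
    open ≡-Reasoning
    regroup : ∀ d s t f w → d * ((s * (t * f)) * w) ≡ s * t * (d * (f * w))
    regroup = solve-∀
    index : ∀ j k → j + 2 * suc k ≡ 2 + j + 2 * k
    index = solve-∀

  weighted-D : ∀ i k → dcoeff i k * weight i k ≡ suc k * suc k * (i + 2 * k) !
  weighted-D i k = begin
    dcoeff i k * weight i k                         ≡⟨ regroup (dcoeff i k) (i !) (suc k) (k !) ⟩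
    suc k * suc k * (dcoeff i k * (i ! * (k ! * k !))) ≡⟨ cong (suc k * suc k *_) (dcoeff-factorial i k) ⟩
    suc k * suc k * (i + 2 * k) !                   ∎
    where
    open ≡-Reasoning
    regroup : ∀ d f s g → d * (f * ((s * g) * (s * g))) ≡ s * s * (d * (f * (g * g)))
    regroup = solve-∀

  dcoeff-recurrence : ∀ i k → let n = i + k in
    suc n * dcoeff i (suc k) + n * dcoeff-pred² i k ≡ suc (2 * n) * (dcoeff-pred i k + 2 * dcoeff i k)
  dcoeff-recurrence i k = *-cancelʳ-≡ _ _ w {{weight≢0 i k}} (begin
    (suc n * x + n * z) * w                                     ≡⟨ distrib₁ (suc n) n x z w ⟩
    suc n * (x * w) + n * (z * w)                               ≡⟨ cong₂ (λ p q → suc n * p + n * q)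
                                                                         (weighted-D-next i k) (weighted-q²D-prev i k) ⟩
    suc n * ((2 + r) * (1 + r) * r !) + n * (i * pred i * r !) ≡⟨ identity i k (r !) ⟩
    suc (2 * n) * (i * (1 + r) * r ! + 2 * (suc k * suc k * r !)) ≡⟨ cong₂ (λ p q → suc (2 * n) * (p + 2 * q))
                                                                         (weighted-qD i k) (weighted-D i k) ⟨
    suc (2 * n) * (y * w + 2 * (u * w))                         ≡⟨ distrib₂ (suc (2 * n)) y u w ⟨
    suc (2 * n) * (y + 2 * u) * w                               ∎)
    where
    open ≡-Reasoning
    n = i + k
    r = i + 2 * k
    w = weight i k
    x = dcoeff i (suc k)
    y = dcoeff-pred i k
    z = dcoeff-pred² i k
    u = dcoeff i k
    distrib₁ : ∀ p q x z w → (p * x + q * z) * w ≡ p * (x * w) + q * (z * w)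
    distrib₁ = solve-∀
    distrib₂ : ∀ p y u w → p * (y + 2 * u) * w ≡ p * (y * w + 2 * (u * w))
    distrib₂ = solve-∀
    identity : ∀ i k t → let n = i + k; r = i + 2 * k in
      suc n * ((2 + r) * (1 + r) * t) + n * (i * pred i * t) ≡ suc (2 * n) * (i * (1 + r) * t + 2 * (suc k * suc k * t))
    identity zero    = solve-∀
    identity (suc j) = identity-suc j
      where
      identity-suc : ∀ j k t →
        suc (suc j + k) * ((3 + j + 2 * k) * (2 + j + 2 * k) * t) + (suc j + k) * (suc j * j * t)
          ≡ suc (2 * (suc j + k)) * (suc j * (2 + j + 2 * k) * t + 2 * (suc k * suc k * t))
      identity-suc = solve-∀

  dcoeff-≤-sucˡ : ∀ i k → dcoeff i k ≤ dcoeff (suc i) k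
  dcoeff-≤-sucˡ i k =
    *-cancelʳ-≤ _ _ (suc i ! * (k ! * k !)) {{m*n≢0 (suc i !) _ {{suc i !≢0}} {{k !* k !≢0}}}} (begin
    dcoeff i k * (suc i ! * (k ! * k !))       ≡⟨ regroup (dcoeff i k) (suc i) (i !) (k ! * k !) ⟩
    suc i * (dcoeff i k * (i ! * (k ! * k !))) ≡⟨ cong (suc i *_) (dcoeff-factorial i k) ⟩
    suc i * (i + 2 * k) !                      ≤⟨ *-monoˡ-≤ ((i + 2 * k) !) (s≤s (m≤m+n i (2 * k))) ⟩
    suc (i + 2 * k) !                          ≡⟨ dcoeff-factorial (suc i) k ⟨
    dcoeff (suc i) k * (suc i ! * (k ! * k !)) ∎)
    where
    open ≤-Reasoning
    regroup : ∀ d s f w → d * ((s * f) * w) ≡ s * (d * (f * w))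
    regroup = solve-∀

open DelannoyCoefficients

open import Data.Nat as ℕ using (ℕ; zero; suc; pred; _∸_; z≤n; s<s)
import Data.Nat.Properties as ℕ
open import Data.Nat.Combinatorics using (_C_)
import Data.Nat.Tactic.RingSolver as ℕ-Solver
open import Data.Integer as ℤ using (ℤ; +_; 0ℤ; 1ℤ; _+_; _*_; _-_; _≤_; +≤+)
import Data.Integer.Properties as ℤ
open import Data.Integer.Tactic.RingSolver using (solve-∀)
open import Algebra.Properties.CommutativeSemigroup ℤ.+-commutativeSemigroup using (interchange)
open import Algebra.Properties.CommutativeSemigroup ℤ.*-commutativeSemigroup using (x∙yz≈y∙xz)
open import Function using (_∘_)
open import Relation.Nullary using (yes; no; contradiction)
open import Data.Sum using (inj₁; inj₂)
open import Relation.Binary.Definitions using (tri<; tri≈; tri>)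

open ≡-Reasoning

sumℤ-cong : ∀ n {f g : ℕ → ℤ} → (∀ {i} → i ℕ.≤ n → f i ≡ g i) → sumℤ n f ≡ sumℤ n g
sumℤ-cong zero    f≡g = f≡g z≤n
sumℤ-cong (suc n) f≡g = cong₂ _+_ (sumℤ-cong n (f≡g ∘ ℕ.m≤n⇒m≤1+n)) (f≡g ℕ.≤-refl)

sumℤ-+ : ∀ n (f g : ℕ → ℤ) → sumℤ n (λ i → f i + g i) ≡ sumℤ n f + sumℤ n g
sumℤ-+ zero    f g = refl
sumℤ-+ (suc n) f g = trans (cong (_+ (f (suc n) + g (suc n))) (sumℤ-+ n f g))
                           (interchange (sumℤ n f) (sumℤ n g) (f (suc n)) (g (suc n)))

sumℤ-*ˡ : ∀ n c (f : ℕ → ℤ) → sumℤ n (λ i → c * f i) ≡ c * sumℤ n f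
sumℤ-*ˡ zero    c f = refl
sumℤ-*ˡ (suc n) c f = trans (cong (_+ c * f (suc n)) (sumℤ-*ˡ n c f)) (sym (ℤ.*-distribˡ-+ c _ _))

sumℤ-mono-≤ : ∀ n {f g : ℕ → ℤ} → (∀ i → f i ≤ g i) → sumℤ n f ≤ sumℤ n g
sumℤ-mono-≤ zero    f≤g = f≤g 0
sumℤ-mono-≤ (suc n) f≤g = ℤ.+-mono-≤ (sumℤ-mono-≤ n f≤g) (f≤g (suc n))

sumℤ-suc : ∀ n (f : ℕ → ℤ) → sumℤ (suc n) f ≡ f 0 + sumℤ n (f ∘ suc)
sumℤ-suc zero    f = refl
sumℤ-suc (suc n) f = trans (cong (_+ f (suc (suc n))) (sumℤ-suc n f)) (ℤ.+-assoc (f 0) _ _)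

sumℤ-reverse : ∀ n (f : ℕ → ℤ) → sumℤ n f ≡ sumℤ n (λ i → f (n ∸ i))
sumℤ-reverse zero    f = refl
sumℤ-reverse (suc n) f = begin
  sumℤ n f + f (suc n)                 ≡⟨ cong (_+ f (suc n)) (sumℤ-reverse n f) ⟩
  sumℤ n (λ i → f (n ∸ i)) + f (suc n) ≡⟨ ℤ.+-comm _ (f (suc n)) ⟩
  f (suc n) + sumℤ n (λ i → f (n ∸ i)) ≡⟨ sumℤ-suc n (λ i → f (suc n ∸ i)) ⟨
  sumℤ (suc n) (λ i → f (suc n ∸ i))   ∎

shift : Poly → Poly
shift f zero    = 0ℤ
shift f (suc m) = f m

shift² : Poly → Poly
shift² = shift ∘ shift

infixl 6 _⊕_ _⊖_
infixr 7 _⊛_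

_⊕_ : Poly → Poly → Poly
(f ⊕ g) m = f m + g m

_⊖_ : Poly → Poly → Poly
(f ⊖ g) m = f m - g m

_⊛_ : ℤ → Poly → Poly
(c ⊛ f) m = c * f m

shift-cong : ∀ {f g} → f ≗ g → shift f ≗ shift g
shift-cong f≗g zero    = refl
shift-cong f≗g (suc m) = f≗g m

shift²-⊖ : ∀ f g → shift² (f ⊖ g) ≗ shift² f ⊖ shift² g
shift²-⊖ f g zero          = refl
shift²-⊖ f g (suc zero)    = refl
shift²-⊖ f g (suc (suc m)) = refl

·-comm : ∀ f g → f · g ≗ g · f
·-comm f g m = begin
  sumℤ m (λ i → f i * g (m ∸ i))             ≡⟨ sumℤ-reverse m _ ⟩
  sumℤ m (λ i → f (m ∸ i) * g (m ∸ (m ∸ i))) ≡⟨ sumℤ-cong m swap ⟩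
  sumℤ m (λ i → g i * f (m ∸ i))             ∎
  where
  swap : ∀ {i} → i ℕ.≤ m → f (m ∸ i) * g (m ∸ (m ∸ i)) ≡ g i * f (m ∸ i)
  swap {i} i≤m = trans (cong (λ j → f (m ∸ i) * g j) (ℕ.m∸[m∸n]≡n i≤m)) (ℤ.*-comm (f (m ∸ i)) (g i))

·-congʳ : ∀ f {g h} → g ≗ h → f · g ≗ f · h
·-congʳ f g≗h m = sumℤ-cong m (λ {i} _ → cong (f i *_) (g≗h (m ∸ i)))

·-distribˡ-⊕ : ∀ f g h → f · (g ⊕ h) ≗ f · g ⊕ f · h
·-distribˡ-⊕ f g h m =
  trans (sumℤ-cong m (λ {i} _ → ℤ.*-distribˡ-+ (f i) (g (m ∸ i)) (h (m ∸ i)))) (sumℤ-+ m _ _)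

·-⊛ : ∀ f c g → f · (c ⊛ g) ≗ c ⊛ (f · g)
·-⊛ f c g m = trans (sumℤ-cong m (λ {i} _ → x∙yz≈y∙xz (f i) c (g (m ∸ i)))) (sumℤ-*ˡ m c _)

·-shiftʳ : ∀ f g → f · shift g ≗ shift (f · g)
·-shiftʳ f g zero    = ℤ.*-zeroʳ (f 0)
·-shiftʳ f g (suc m) = begin
  sumℤ m (λ i → f i * shift g (suc m ∸ i)) + f (suc m) * shift g (m ∸ m)
    ≡⟨ cong₂ _+_ (sumℤ-cong m (λ {i} i≤m → cong (λ j → f i * shift g j) (ℕ.+-∸-assoc 1 i≤m)))
                 (cong (λ j → f (suc m) * shift g j) (ℕ.n∸n≡0 m)) ⟩
  sumℤ m (λ i → f i * g (m ∸ i)) + f (suc m) * 0ℤ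
    ≡⟨ cong (_+_ (sumℤ m (λ i → f i * g (m ∸ i)))) (ℤ.*-zeroʳ (f (suc m))) ⟩
  sumℤ m (λ i → f i * g (m ∸ i)) + 0ℤ
    ≡⟨ ℤ.+-identityʳ _ ⟩
  sumℤ m (λ i → f i * g (m ∸ i)) ∎

·-shift²ʳ : ∀ f g → f · shift² g ≗ shift² (f · g)
·-shift²ʳ f g m = trans (·-shiftʳ f (shift g) m) (shift-cong (·-shiftʳ f g) m)

shift-·-shift : ∀ f g → shift f · shift g ≗ shift² (f · g)
shift-·-shift f g m = begin
  (shift f · shift g) m     ≡⟨ ·-shiftʳ (shift f) g m ⟩
  shift (shift f · g) m     ≡⟨ shift-cong (·-comm (shift f) g) m ⟩
  shift (g · shift f) m     ≡⟨ shift-cong (·-shiftʳ g f) m ⟩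
  shift² (g · f) m          ≡⟨ shift-cong (shift-cong (·-comm g f)) m ⟩
  shift² (f · g) m          ∎

NonNeg : Poly → Set
NonNeg f = ∀ m → 0ℤ ≤ f m

shift-nonneg : ∀ {f} → NonNeg f → NonNeg (shift f)
shift-nonneg f≥0 zero    = ℤ.≤-refl
shift-nonneg f≥0 (suc m) = f≥0 m

≤q⇒≤ : ∀ {f g} → f ≤q g → ∀ m → f m ≤ g m
≤q⇒≤ f≤g m = ℤ.0≤i-j⇒j≤i (f≤g m)

≤⇒≤q : ∀ {f g} → (∀ m → f m ≤ g m) → f ≤q g
≤⇒≤q f≤g m = ℤ.i≤j⇒0≤j-i (f≤g m)

·-mono-≤q : ∀ {f f′ g g′} → NonNeg f → NonNeg g → f ≤q f′ → g ≤q g′ → (f · g) ≤q (f′ · g′)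
·-mono-≤q {f} {f′} {g} {g′} f≥0 g≥0 f≤f′ g≤g′ =
  ≤⇒≤q (λ m → sumℤ-mono-≤ m (λ i → termwise i (m ∸ i)))
  where
  termwise : ∀ i j → f i * g j ≤ f′ i * g′ j
  termwise i j = ℤ.≤-trans
    (ℤ.*-monoʳ-≤-nonNeg (g j) {{ℤ.nonNegative (g≥0 j)}} fi≤f′i)
    (ℤ.*-monoˡ-≤-nonNeg (f′ i) {{ℤ.nonNegative (ℤ.≤-trans (f≥0 i) fi≤f′i)}} (≤q⇒≤ {g} {g′} g≤g′ j))
    where
    fi≤f′i = ≤q⇒≤ {f} {f′} f≤f′ i

-- Coefficients of D

mono-diag : ∀ c e → mono c e e ≡ + c
mono-diag c zero    = refl
mono-diag c (suc e) = mono-diag c e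

mono-off : ∀ c {e m} → m ≢ e → mono c e m ≡ 0ℤ
mono-off c {zero}  {zero}  m≢e = contradiction refl m≢e
mono-off c {suc e} {zero}  _   = refl
mono-off c {zero}  {suc m} _   = refl
mono-off c {suc e} {suc m} m≢e = mono-off c (m≢e ∘ cong suc)

coeff-Σmono-vanish : ∀ (a : ℕ → ℕ) {n m} → n ℕ.< m → sumℤ n (λ j → mono (a j) j m) ≡ 0ℤ
coeff-Σmono-vanish a {zero}  0<m = mono-off (a 0) (ℕ.>⇒≢ 0<m)
coeff-Σmono-vanish a {suc n} n<m =
  cong₂ _+_ (coeff-Σmono-vanish a (ℕ.<-trans (ℕ.n<1+n n) n<m)) (mono-off (a (suc n)) (ℕ.>⇒≢ n<m))

coeff-Σmono : ∀ (a : ℕ → ℕ) {n m} → m ℕ.≤ n → sumℤ n (λ j → mono (a j) j m) ≡ + a m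
coeff-Σmono a {zero}      z≤n   = refl
coeff-Σmono a {suc n} {m} m≤1+n with ℕ.m≤n⇒m<n∨m≡n m≤1+n
... | inj₁ m<1+n = trans (cong₂ _+_ (coeff-Σmono a (ℕ.≤-pred m<1+n)) (mono-off (a (suc n)) (ℕ.<⇒≢ m<1+n)))
                         (ℤ.+-identityʳ _)
... | inj₂ refl  = trans (cong₂ _+_ (coeff-Σmono-vanish a (ℕ.n<1+n n)) (mono-diag (a (suc n)) (suc n)))
                         (ℤ.+-identityˡ _)

D-as-Σmono : ∀ n m → D n m ≡ sumℤ n (λ j → mono (((n ℕ.+ (n ∸ j)) C j) ℕ.* ((2 ℕ.* (n ∸ j)) C (n ∸ j))) j m)
D-as-Σmono n m = trans (sumℤ-reverse n _) (sumℤ-cong n exponent)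
  where
  exponent : ∀ {j} → j ℕ.≤ n →
    mono (((n ℕ.+ (n ∸ j)) C (n ∸ (n ∸ j))) ℕ.* ((2 ℕ.* (n ∸ j)) C (n ∸ j))) (n ∸ (n ∸ j)) m
      ≡ mono (((n ℕ.+ (n ∸ j)) C j) ℕ.* ((2 ℕ.* (n ∸ j)) C (n ∸ j))) j m
  exponent {j} j≤n =
    cong (λ i → mono (((n ℕ.+ (n ∸ j)) C i) ℕ.* ((2 ℕ.* (n ∸ j)) C (n ∸ j))) i m) (ℕ.m∸[m∸n]≡n j≤n)

D-coeff : ∀ m k {n} → m ℕ.+ k ≡ n → D n m ≡ + dcoeff m k
D-coeff m k refl = begin
  D (m ℕ.+ k) m
    ≡⟨ D-as-Σmono (m ℕ.+ k) m ⟩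
  _
    ≡⟨ coeff-Σmono _ (ℕ.m≤m+n m k) ⟩
  + (((m ℕ.+ k ℕ.+ (m ℕ.+ k ∸ m)) C m) ℕ.* ((2 ℕ.* (m ℕ.+ k ∸ m)) C (m ℕ.+ k ∸ m)))
    ≡⟨ cong (λ j → + (((m ℕ.+ k ℕ.+ j) C m) ℕ.* ((2 ℕ.* j) C j))) (ℕ.m+n∸m≡n m k) ⟩
  + (((m ℕ.+ k ℕ.+ k) C m) ℕ.* ((2 ℕ.* k) C k))
    ≡⟨ cong (λ i → + ((i C m) ℕ.* ((2 ℕ.* k) C k))) (index m k) ⟩
  + dcoeff m k ∎
  where
  index : ∀ m k → m ℕ.+ k ℕ.+ k ≡ m ℕ.+ 2 ℕ.* k
  index = ℕ-Solver.solve-∀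

D-vanish : ∀ {n m} → n ℕ.< m → D n m ≡ 0ℤ
D-vanish {n} {m} n<m = trans (D-as-Σmono n m) (coeff-Σmono-vanish _ n<m)

D-top : ∀ n → D n n ≡ 1ℤ
D-top n = trans (D-coeff n 0 (ℕ.+-identityʳ n)) (cong +_ (dcoeff-diag n))

D-nonneg : ∀ n → NonNeg (D n)
D-nonneg n m with m ℕ.≤? n
... | yes m≤n = subst (0ℤ ≤_) (sym (D-coeff m (n ∸ m) (ℕ.m+[n∸m]≡n m≤n))) (+≤+ z≤n)
... | no  m≰n = subst (0ℤ ≤_) (sym (D-vanish (ℕ.≰⇒> m≰n))) ℤ.≤-refl

shift-D≤D : ∀ n → shift (D n) ≤q D (suc n)
shift-D≤D n = ≤⇒≤q coefficientwise
  where
  coefficientwise : ∀ m → shift (D n) m ≤ D (suc n) m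
  coefficientwise zero    = D-nonneg (suc n) 0
  coefficientwise (suc i) with i ℕ.≤? n
  ... | yes i≤n = subst₂ _≤_ (sym (D-coeff i (n ∸ i) i+k≡n)) (sym (D-coeff (suc i) (n ∸ i) (cong suc i+k≡n)))
                          (+≤+ (dcoeff-≤-sucˡ i (n ∸ i)))
    where
    i+k≡n = ℕ.m+[n∸m]≡n i≤n
  ... | no  i≰n = subst (_≤ D (suc n) (suc i)) (sym (D-vanish (ℕ.≰⇒> i≰n))) (D-nonneg (suc n) (suc i))

-- The three-term recurrence

-- For n = 0 the term D (pred 0) = D 0 stands in for D₋₁; it is multiplied by n = 0.
RecurrenceAt : ℕ → ℕ → Set
RecurrenceAt n m =
  + suc n * D (suc n) m + + n * shift² (D (pred n)) m ≡ + suc (2 ℕ.* n) * (shift (D n) m + + 2 * D n m)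

recurrence-from-ℕ : ∀ n {X Y Z U x y z u} → X ≡ + x → Y ≡ + y → Z ≡ + z → U ≡ + u →
  suc n ℕ.* x ℕ.+ n ℕ.* z ≡ suc (2 ℕ.* n) ℕ.* (y ℕ.+ 2 ℕ.* u) →
  + suc n * X + + n * Z ≡ + suc (2 ℕ.* n) * (Y + + 2 * U)
recurrence-from-ℕ n {x = x} {y} {z} {u} refl refl refl refl eq = begin
  + suc n * + x + + n * + z               ≡⟨ cong₂ _+_ (ℤ.pos-* (suc n) x) (ℤ.pos-* n z) ⟨
  + (suc n ℕ.* x) + + (n ℕ.* z)           ≡⟨ ℤ.pos-+ (suc n ℕ.* x) (n ℕ.* z) ⟨
  + (suc n ℕ.* x ℕ.+ n ℕ.* z)             ≡⟨ cong +_ eq ⟩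
  + (suc (2 ℕ.* n) ℕ.* (y ℕ.+ 2 ℕ.* u))   ≡⟨ ℤ.pos-* (suc (2 ℕ.* n)) (y ℕ.+ 2 ℕ.* u) ⟩
  + suc (2 ℕ.* n) * + (y ℕ.+ 2 ℕ.* u)     ≡⟨ cong (+ suc (2 ℕ.* n) *_) (ℤ.pos-+ y (2 ℕ.* u)) ⟩
  + suc (2 ℕ.* n) * (+ y + + (2 ℕ.* u))   ≡⟨ cong (λ v → + suc (2 ℕ.* n) * (+ y + v)) (ℤ.pos-* 2 u) ⟩
  + suc (2 ℕ.* n) * (+ y + + 2 * + u)     ∎

shift-D-coeff : ∀ i k → shift (D (i ℕ.+ k)) i ≡ + dcoeff-pred i k
shift-D-coeff zero    k = refl
shift-D-coeff (suc i) k = D-coeff i (suc k) (ℕ.+-suc i k)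

shift²-D-coeff : ∀ i k → shift² (D (pred (i ℕ.+ k))) i ≡ + dcoeff-pred² i k
shift²-D-coeff zero    k = refl
shift²-D-coeff (suc i) k = shift-D-coeff i k

recurrence-below : ∀ i k → RecurrenceAt (i ℕ.+ k) i
recurrence-below i k =
  recurrence-from-ℕ (i ℕ.+ k) (D-coeff i (suc k) (ℕ.+-suc i k)) (shift-D-coeff i k) (shift²-D-coeff i k)
                    (D-coeff i k refl) (dcoeff-recurrence i k)

recurrence-top : ∀ n → RecurrenceAt (suc n) (suc (suc n))
recurrence-top n =
  recurrence-from-ℕ (suc n) (D-top (suc (suc n))) (D-top (suc n)) (D-top n) (D-vanish (ℕ.n<1+n (suc n)))
                    (identity n)
  where
  identity : ∀ n → suc (suc n) ℕ.* 1 ℕ.+ suc n ℕ.* 1 ≡ suc (2 ℕ.* suc n) ℕ.* (1 ℕ.+ 2 ℕ.* 0)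
  identity = ℕ-Solver.solve-∀

recurrence-beyond : ∀ n {m} → suc (suc n) ℕ.< m → RecurrenceAt (suc n) m
recurrence-beyond n {suc (suc m)} (s<s (s<s n<m)) =
  recurrence-from-ℕ (suc n) (D-vanish (s<s (s<s n<m))) (D-vanish (s<s n<m)) (D-vanish n<m)
                    (D-vanish (ℕ.m<n⇒m<1+n (s<s n<m))) (identity n)
  where
  identity : ∀ n → suc (suc n) ℕ.* 0 ℕ.+ suc n ℕ.* 0 ≡ suc (2 ℕ.* suc n) ℕ.* (0 ℕ.+ 2 ℕ.* 0)
  identity = ℕ-Solver.solve-∀

D-recurrence : ∀ n →
  + suc n ⊛ D (suc n) ⊕ + n ⊛ shift² (D (pred n)) ≗ + suc (2 ℕ.* n) ⊛ (shift (D n) ⊕ + 2 ⊛ D n)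
D-recurrence zero    zero          = refl
D-recurrence zero    (suc zero)    = refl
D-recurrence zero    (suc (suc m)) = refl
D-recurrence (suc n) m with ℕ.<-cmp m (suc (suc n))
... | tri< m<2+n _ _ =
  subst (λ n′ → RecurrenceAt n′ m) (ℕ.m+[n∸m]≡n (ℕ.≤-pred m<2+n)) (recurrence-below m (suc n ∸ m))
... | tri≈ _ refl _ = recurrence-top n
... | tri> _ _ 2+n<m = recurrence-beyond n 2+n<m

·-recurrence : ∀ f n m →
  + suc n * (f · D (suc n)) m + + n * shift² (f · D (pred n)) m
    ≡ + suc (2 ℕ.* n) * (shift (f · D n) m + + 2 * (f · D n) m)
·-recurrence f n m = begin
  + suc n * (f · D (suc n)) m + + n * shift² (f · D (pred n)) m
    ≡⟨ cong (λ v → + suc n * (f · D (suc n)) m + + n * v) (·-shift²ʳ f (D (pred n)) m) ⟨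
  + suc n * (f · D (suc n)) m + + n * (f · shift² (D (pred n))) m
    ≡⟨ cong₂ _+_ (·-⊛ f (+ suc n) (D (suc n)) m) (·-⊛ f (+ n) (shift² (D (pred n))) m) ⟨
  (f · (+ suc n ⊛ D (suc n))) m + (f · (+ n ⊛ shift² (D (pred n)))) m
    ≡⟨ ·-distribˡ-⊕ f (+ suc n ⊛ D (suc n)) (+ n ⊛ shift² (D (pred n))) m ⟨
  (f · (+ suc n ⊛ D (suc n) ⊕ + n ⊛ shift² (D (pred n)))) m
    ≡⟨ ·-congʳ f (D-recurrence n) m ⟩
  (f · (+ suc (2 ℕ.* n) ⊛ (shift (D n) ⊕ + 2 ⊛ D n))) m
    ≡⟨ ·-⊛ f (+ suc (2 ℕ.* n)) (shift (D n) ⊕ + 2 ⊛ D n) m ⟩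
  + suc (2 ℕ.* n) * (f · (shift (D n) ⊕ + 2 ⊛ D n)) m
    ≡⟨ cong (+ suc (2 ℕ.* n) *_) (·-distribˡ-⊕ f (shift (D n)) (+ 2 ⊛ D n) m) ⟩
  + suc (2 ℕ.* n) * ((f · shift (D n)) m + (f · (+ 2 ⊛ D n)) m)
    ≡⟨ cong (+ suc (2 ℕ.* n) *_) (cong₂ _+_ (·-shiftʳ f (D n) m) (·-⊛ f (+ 2) (D n) m)) ⟩
  + suc (2 ℕ.* n) * (shift (f · D n) m + + 2 * (f · D n) m) ∎

-- Log-convexity

-- (2N + 1) times the first hypothesis minus (2N + 3) times the second.
log-convexity-identity : ∀ N u₁ u₂ u₃ u₄ w {C E} → E ≡ 1ℤ + + 2 * N → C ≡ 1ℤ + + 2 * (1ℤ + N) →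
  (1ℤ + (1ℤ + N)) * u₁ + (1ℤ + N) * u₃ ≡ C * w →
  (1ℤ + N) * u₂ + N * u₄ ≡ E * w →
  E * (1ℤ + (1ℤ + N)) * (u₁ - u₂) ≡ (u₂ - u₃) + N * C * (u₄ - u₃)
log-convexity-identity N u₁ u₂ u₃ u₄ w refl refl e₁ e₂ = begin
  E * (1ℤ + (1ℤ + N)) * (u₁ - u₂)
    ≡⟨ combination N u₁ u₂ u₃ u₄ w ⟩
  R + E * (L₁ - C * w) - C * (L₂ - E * w)
    ≡⟨ cong₂ (λ a b → R + E * a - C * b) (ℤ.i≡j⇒i-j≡0 e₁) (ℤ.i≡j⇒i-j≡0 e₂) ⟩
  R + E * 0ℤ - C * 0ℤ
    ≡⟨ drop-zeros R E C ⟩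
  R ∎
  where
  E = 1ℤ + + 2 * N
  C = 1ℤ + + 2 * (1ℤ + N)
  L₁ = (1ℤ + (1ℤ + N)) * u₁ + (1ℤ + N) * u₃
  L₂ = (1ℤ + N) * u₂ + N * u₄
  R = (u₂ - u₃) + N * C * (u₄ - u₃)
  combination : ∀ N u₁ u₂ u₃ u₄ w → let E = 1ℤ + + 2 * N; C = 1ℤ + + 2 * (1ℤ + N) in
    E * (1ℤ + (1ℤ + N)) * (u₁ - u₂)
      ≡ (u₂ - u₃) + N * C * (u₄ - u₃)
        + E * ((1ℤ + (1ℤ + N)) * u₁ + (1ℤ + N) * u₃ - C * w) - C * ((1ℤ + N) * u₂ + N * u₄ - E * w)
  combination = solve-∀
  drop-zeros : ∀ R E C → R + E * 0ℤ - C * 0ℤ ≡ R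
  drop-zeros = solve-∀

-- defect 0 uses D 0 for D₋₁; it only enters with the factor n = 0.
defect : ℕ → Poly
defect n = D (pred n) · D (suc n) ⊖ D n · D n

defect-recurrence : ∀ n →
  (+ suc (2 ℕ.* n) * + suc (suc n)) ⊛ defect (suc n)
    ≗ (D (suc n) · D (suc n) ⊖ shift (D n) · shift (D n)) ⊕ (+ n * + suc (2 ℕ.* suc n)) ⊛ shift² (defect n)
defect-recurrence n m = begin
  + suc (2 ℕ.* n) * + suc (suc n) * (u₁ - u₂)
    ≡⟨ log-convexity-identity (+ n) u₁ u₂ u₃ u₄ w (cong (_+_ 1ℤ) (ℤ.pos-* 2 n)) (cong (_+_ 1ℤ) (ℤ.pos-* 2 (suc n)))
                              e₁ e₂ ⟩
  (u₂ - u₃) + + n * + suc (2 ℕ.* suc n) * (u₄ - u₃)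
    ≡⟨ cong₂ (λ a b → (u₂ - a) + + n * + suc (2 ℕ.* suc n) * b)
             (shift-·-shift A A m) (shift²-⊖ (Z · B) (A · A) m) ⟨
  (u₂ - (shift A · shift A) m) + + n * + suc (2 ℕ.* suc n) * shift² (defect n) m ∎
  where
  A = D n
  B = D (suc n)
  Z = D (pred n)
  u₁ = (A · D (suc (suc n))) m
  u₂ = (B · B) m
  u₃ = shift² (A · A) m
  u₄ = shift² (Z · B) m
  w = shift (A · B) m + + 2 * (A · B) m
  e₁ : + suc (suc n) * u₁ + + suc n * u₃ ≡ + suc (2 ℕ.* suc n) * w
  e₁ = ·-recurrence A (suc n) m
  e₂ : + suc n * u₂ + + n * u₄ ≡ + suc (2 ℕ.* n) * w
  e₂ = begin
    + suc n * u₂ + + n * u₄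
      ≡⟨ cong (λ v → + suc n * u₂ + + n * v) (shift-cong (shift-cong (·-comm Z B)) m) ⟩
    + suc n * u₂ + + n * shift² (B · Z) m
      ≡⟨ ·-recurrence B n m ⟩
    + suc (2 ℕ.* n) * (shift (B · A) m + + 2 * (B · A) m)
      ≡⟨ cong₂ (λ a b → + suc (2 ℕ.* n) * (a + + 2 * b)) (shift-cong (·-comm B A) m) (·-comm B A m) ⟩
    + suc (2 ℕ.* n) * w ∎

0≤i⇒0≤k*i : ∀ k .{{_ : ℤ.NonNegative k}} {i} → 0ℤ ≤ i → 0ℤ ≤ k * i
0≤i⇒0≤k*i k {i} 0≤i = subst (_≤ k * i) (ℤ.*-zeroʳ k) (ℤ.*-monoˡ-≤-nonNeg k 0≤i)

0≤k*i⇒0≤i : ∀ k .{{_ : ℤ.Positive k}} {i} → 0ℤ ≤ k * i → 0ℤ ≤ i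
0≤k*i⇒0≤i k {i} 0≤ki = ℤ.*-cancelˡ-≤-pos 0ℤ i k (subst (_≤ k * i) (sym (ℤ.*-zeroʳ k)) 0≤ki)

log-convexity-step : ∀ n →
  NonNeg ((+ n * + suc (2 ℕ.* suc n)) ⊛ shift² (defect n)) → NonNeg (defect (suc n))
log-convexity-step n scaled-defect≥0 m =
  0≤k*i⇒0≤i (+ suc (2 ℕ.* n) * + suc (suc n))
    (subst (0ℤ ≤_) (sym (defect-recurrence n m)) (ℤ.+-mono-≤ (squares m) (scaled-defect≥0 m)))
  where
  squares : NonNeg (D (suc n) · D (suc n) ⊖ shift (D n) · shift (D n))
  squares = ·-mono-≤q {f′ = D (suc n)} {g′ = D (suc n)} qDₙ≥0 qDₙ≥0 (shift-D≤D n) (shift-D≤D n)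
    where
    qDₙ≥0 = shift-nonneg (D-nonneg n)

corollary4p11 : q-log-convex D
corollary4p11 zero    = log-convexity-step zero (λ _ → ℤ.≤-refl)
corollary4p11 (suc n) = log-convexity-step (suc n) λ m →
  0≤i⇒0≤k*i (+ suc n * + suc (2 ℕ.* suc (suc n))) (shift-nonneg (shift-nonneg (corollary4p11 n)) m)
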